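{- Let $G$ be a finite graph. If $G$ has a pairing dominating set consisting of $\gamma(G)$ pairs, then Alice (playing first) has a winning strategy in the Maker-Maker domination game on $G$.
   Context: Maker-Maker domination game: on a finite simple graph $G=(V,E)$, Alice and Bob alternately claim previously unclaimed vertices, Alice first; the first player whose claimed vertices form a dominating set of $G$ wins; if all vertices are claimed and nobody dominates, it is a draw. $\gamma(G)$ is the minimum size of a dominating set of $G$, and $N[x]$ the closed neighbourhood. A pairing dominating set of $G$ is a set of pairs $\{(u_1,v_1),\dots,(u_k,v_k)\}$ of vertices, all $2k$ vertices distinct, such that $V=\bigcup_{i=1}^k \big(N[u_i]\cap N[v_i]\big)$ (equivalently, every set containing at least one vertex of each pair is dominating); its size is $k$. -}

module Defs where

open import Data.Nat using (ℕ; suc; _≤_)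
open import Data.Fin using (Fin)
open import Data.Fin.Subset using (Subset; _∈_; _∉_; _∪_; ⁅_⁆; ∣_∣)
open import Data.Bool using (Bool; true; false)
open import Data.Product using (Σ; ∃; _×_; _,_)
open import Data.Sum using (_⊎_)
open import Data.List using (List; []; _∷_; length; concatMap)
open import Data.List.Relation.Unary.Any using (Any)
open import Data.List.Relation.Unary.Unique.Propositional using (Unique)
open import Relation.Binary.PropositionalEquality using (_≡_)
open import Relation.Nullary using (¬_)

record Graph (n : ℕ) : Set where
  field
    adj   : Fin n → Fin n → Bool
    sym   : ∀ u v → adj u v ≡ adj v u
    irrefl : ∀ v → adj v v ≡ false
open Graph public

module _ {n : ℕ} (G : Graph n) where

  InClosedNbhd : Fin n → Fin n → Set
  InClosedNbhd x w = w ≡ x ⊎ adj G x w ≡ true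

  Dominating : Subset n → Set
  Dominating S = ∀ w → ∃ λ u → u ∈ S × InClosedNbhd u w

  IsDominationNumber : ℕ → Set
  IsDominationNumber k =
    (Σ (Subset n) λ S → Dominating S × ∣ S ∣ ≡ k) ×
    (∀ S → Dominating S → k ≤ ∣ S ∣)

  pairVertices : List (Fin n × Fin n) → List (Fin n)
  pairVertices = concatMap (λ { (u , v) → u ∷ v ∷ [] })

  record PairingDominatingSet : Set where
    field
      pairs    : List (Fin n × Fin n)
      distinct : Unique (pairVertices pairs)
      covers   : ∀ w → Any (λ { (u , v) → InClosedNbhd u w × InClosedNbhd v w }) pairs

  size : PairingDominatingSet → ℕ
  size P = length (PairingDominatingSet.pairs P)

  -- A position is (A , B): the vertex sets
  -- claimed so far by Alice and Bob (neither dominating).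
  -- A player whose claimed set becomes dominating wins immediately; if all
  -- vertices are claimed with nobody dominating, the game is a draw
  -- (in particular no Alice-win when Bob has no move).
  Unclaimed : Subset n → Subset n → Fin n → Set
  Unclaimed A B v = v ∉ A × v ∉ B

  data AliceWinsAliceToMove (A B : Subset n) : Set
  data AliceWinsBobToMove (A B : Subset n) : Set

  data AliceWinsAliceToMove A B where
    winNow : ∀ v → Unclaimed A B v → Dominating (A ∪ ⁅ v ⁆) →
             AliceWinsAliceToMove A B
    move   : ∀ v → Unclaimed A B v → ¬ Dominating (A ∪ ⁅ v ⁆) →
             AliceWinsBobToMove (A ∪ ⁅ v ⁆) B → AliceWinsAliceToMove A B

  data AliceWinsBobToMove A B where
    bobMoves : (∃ λ v → Unclaimed A B v) →
               (∀ v → Unclaimed A B v →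
                  ¬ Dominating (B ∪ ⁅ v ⁆) × AliceWinsAliceToMove A (B ∪ ⁅ v ⁆)) →
               AliceWinsBobToMove A B

  AliceHasWinningStrategy : Set
  AliceHasWinningStrategy = AliceWinsAliceToMove Data.Fin.Subset.⊥ Data.Fin.Subset.⊥

-- Alice claims one vertex of the first pair.  From then on, whenever Bob claims
-- a vertex of a still intact pair, Alice claims its partner; otherwise she claims
-- a vertex of any intact pair.  Each round destroys exactly one intact pair and
-- gives Alice a vertex of it, so after γ moves she holds a vertex of every pair
-- and dominates.  Bob, in the meantime, has claimed at most γ - 1 vertices, too
-- few to dominate.
module Submission where

open import Defs hiding (sym)
open import Data.Nat using (ℕ; zero; suc; _+_; _≤_; _<_; z≤n; s≤s)
open import Data.Nat.Properties
  using (≤-trans; ≤-reflexive; +-suc; +-comm; +-monoˡ-≤; +-monoʳ-≤; n≤1+n; m≤m+n; suc-injective; <-irrefl; module ≤-Reasoning)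
open import Data.Fin using (Fin; _≟_)
open import Data.Fin.Subset using (Subset; outside; inside; _∈_; _∉_; _∪_; ⁅_⁆; ∣_∣; ⊥)
open import Data.Fin.Subset.Properties using (_∈?_; ∉⊥; ∣⊥∣≡0; ∣⁅x⁆∣≡1; x∈⁅x⁆; x∈⁅y⁆⇒x≡y; x∈p∪q⁺; x∈p∪q⁻)
open import Data.Fin.Properties using (any?; all?)
open import Data.Bool as Bool using (true)
open import Data.Vec using ([]; _∷_)
open import Data.Product using (Σ; ∃; _×_; _,_; map₂)
open import Data.Sum as Sum using (_⊎_; inj₁; inj₂; [_,_])
open import Data.List using (List; []; _∷_; length)
open import Data.List.Membership.Propositional using (find; lose) renaming (_∈_ to _∈ᴸ_)
open import Data.List.Relation.Binary.Subset.Propositional using () renaming (_⊆_ to _⊆ᴸ_)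
open import Data.List.Relation.Binary.Subset.Propositional.Properties using (∷⁺ʳ)
open import Data.List.Relation.Unary.Any as Any using (Any; here; there)
open import Data.List.Relation.Unary.All as All using (All; []; _∷_)
open import Data.List.Relation.Unary.All.Properties using (anti-mono)
open import Data.List.Relation.Unary.AllPairs as AllPairs using (_∷_)
open import Data.List.Relation.Unary.Unique.Propositional using (Unique)
open import Relation.Binary.Definitions using (DecidableEquality)
open import Relation.Binary.PropositionalEquality using (_≡_; _≢_; refl; sym; trans; cong; subst; ≢-sym)
open import Relation.Nullary using (¬_; Dec; yes; no; ¬?)
open import Relation.Nullary.Decidable using (_×-dec_; _⊎-dec_)
open import Data.Empty using (⊥-elim)

∣p∪q∣≤∣p∣+∣q∣ : ∀ {n} (p q : Subset n) → ∣ p ∪ q ∣ ≤ ∣ p ∣ + ∣ q ∣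
∣p∪q∣≤∣p∣+∣q∣ []            []            = z≤n
∣p∪q∣≤∣p∣+∣q∣ (outside ∷ p) (outside ∷ q) = ∣p∪q∣≤∣p∣+∣q∣ p q
∣p∪q∣≤∣p∣+∣q∣ (outside ∷ p) (inside ∷ q)  =
  ≤-trans (s≤s (∣p∪q∣≤∣p∣+∣q∣ p q)) (≤-reflexive (sym (+-suc ∣ p ∣ ∣ q ∣)))
∣p∪q∣≤∣p∣+∣q∣ (inside ∷ p)  (outside ∷ q) = s≤s (∣p∪q∣≤∣p∣+∣q∣ p q)
∣p∪q∣≤∣p∣+∣q∣ (inside ∷ p)  (inside ∷ q)  =
  s≤s (≤-trans (∣p∪q∣≤∣p∣+∣q∣ p q) (+-monoʳ-≤ ∣ p ∣ (n≤1+n ∣ q ∣)))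

∣p∪⁅x⁆∣≤1+∣p∣ : ∀ {n} (p : Subset n) (x : Fin n) → ∣ p ∪ ⁅ x ⁆ ∣ ≤ suc ∣ p ∣
∣p∪⁅x⁆∣≤1+∣p∣ p x = begin
  ∣ p ∪ ⁅ x ⁆ ∣     ≤⟨ ∣p∪q∣≤∣p∣+∣q∣ p ⁅ x ⁆ ⟩
  ∣ p ∣ + ∣ ⁅ x ⁆ ∣ ≡⟨ cong (∣ p ∣ +_) (∣⁅x⁆∣≡1 x) ⟩
  ∣ p ∣ + 1         ≡⟨ +-comm ∣ p ∣ 1 ⟩
  suc ∣ p ∣         ∎
  where open ≤-Reasoning

x∉p∪⁅y⁆ : ∀ {n} {p : Subset n} {x y : Fin n} → x ∉ p → x ≢ y → x ∉ p ∪ ⁅ y ⁆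
x∉p∪⁅y⁆ {p = p} {y = y} x∉p x≢y x∈p∪⁅y⁆ with x∈p∪q⁻ p ⁅ y ⁆ x∈p∪⁅y⁆
... | inj₁ x∈p   = x∉p x∈p
... | inj₂ x∈⁅y⁆ = x≢y (x∈⁅y⁆⇒x≡y y x∈⁅y⁆)

module PairRemoval {a} {A : Set a} (_≟ᴬ_ : DecidableEquality A) where

  vertices : List (A × A) → List A
  vertices []            = []
  vertices ((u , v) ∷ R) = u ∷ v ∷ vertices R

  _∈ᵖ_ : A → A × A → Set a
  x ∈ᵖ (u , v) = x ≡ u ⊎ x ≡ v

  record Removal (x : A) (R : List (A × A)) : Set a where
    field
      rest        : List (A × A)
      x∈R         : x ∈ᴸ vertices R
      x∉rest      : All (x ≢_) (vertices rest)
      rest⊆R      : vertices rest ⊆ᴸ vertices R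
      unique      : Unique (vertices rest)
      length-rest : length R ≡ suc (length rest)
      covered     : ∀ {p} → p ∈ᴸ R → p ∈ᴸ rest ⊎ x ∈ᵖ p

  removeHead : ∀ {x a b R} → x ∈ᵖ (a , b) → Unique (vertices ((a , b) ∷ R)) →
               Removal x ((a , b) ∷ R)
  removeHead {R = R} x∈ab unique = record
    { rest        = R
    ; x∈R         = [ (λ { refl → here refl }) , (λ { refl → there (here refl) }) ] x∈ab
    ; x∉rest      = [ (λ { refl → a∉R }) , (λ { refl → b∉R }) ] x∈ab
    ; rest⊆R      = λ y∈R → there (there y∈R)
    ; unique      = R-unique
    ; length-rest = refl
    ; covered     = λ { (here refl) → inj₂ x∈ab ; (there p∈R) → inj₁ p∈R }
    }
    where
      a∉R = All.tail (AllPairs.head unique)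
      b∉R = AllPairs.head (AllPairs.tail unique)
      R-unique = AllPairs.tail (AllPairs.tail unique)

  consRemoval : ∀ {x a b R} → Unique (vertices ((a , b) ∷ R)) → Removal x R →
                Removal x ((a , b) ∷ R)
  consRemoval {a = a} {b} ab∷R-unique r = record
    { rest        = (a , b) ∷ rest
    ; x∈R         = there (there x∈R)
    ; x∉rest      = ≢-sym (All.lookup a∉R x∈R) ∷ ≢-sym (All.lookup b∉R x∈R) ∷ x∉rest
    ; rest⊆R      = ∷⁺ʳ a (∷⁺ʳ b rest⊆R)
    ; unique      = (a≢b ∷ anti-mono rest⊆R a∉R) ∷ anti-mono rest⊆R b∉R ∷ unique
    ; length-rest = cong suc length-rest
    ; covered     = λ { (here refl) → inj₁ (here refl) ; (there p∈R) → Sum.map₁ there (covered p∈R) }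
    }
    where
      open Removal r
      a≢b = All.head (AllPairs.head ab∷R-unique)
      a∉R = All.tail (AllPairs.head ab∷R-unique)
      b∉R = AllPairs.head (AllPairs.tail ab∷R-unique)

  Answer : A → List (A × A) → Set a
  Answer v R = ∃ λ x → x ≢ v × Σ (Removal x R) λ r → All (v ≢_) (vertices (Removal.rest r))

  respond : ∀ v {a b R} → Unique (vertices ((a , b) ∷ R)) → Answer v ((a , b) ∷ R)
  respond v {a} {b} {R} unique@((a≢b ∷ a∉R) ∷ b∉R ∷ _)
    with v ≟ᴬ a | v ≟ᴬ b | All.all? (λ y → ¬? (v ≟ᴬ y)) (vertices R)
  ... | yes refl | _        | _      = b , ≢-sym a≢b , removeHead (inj₂ refl) unique , a∉R
  ... | no v≢a   | yes refl | _      = a , a≢b , removeHead (inj₁ refl) unique , b∉R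
  ... | no v≢a   | no _     | yes v∉R = a , ≢-sym v≢a , removeHead (inj₁ refl) unique , v∉R
  ... | no v≢a   | no v≢b   | no v∈R = respondInTail unique v∈R
    where
      respondInTail : ∀ {S} → Unique (vertices ((a , b) ∷ S)) → ¬ All (v ≢_) (vertices S) →
                      Answer v ((a , b) ∷ S)
      respondInTail {[]}    _ v∈S = ⊥-elim (v∈S [])
      respondInTail {_ ∷ _} ab∷S-unique _ with respond v (AllPairs.tail (AllPairs.tail ab∷S-unique))
      ... | x , x≢v , r , v∉rest = x , x≢v , consRemoval ab∷S-unique r , v≢a ∷ v≢b ∷ v∉rest

module _ {n : ℕ} (G : Graph n) where

  open PairRemoval (_≟_ {n})

  Dominates : Subset n → Fin n → Set
  Dominates S w = ∃ λ u → u ∈ S × InClosedNbhd G u w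

  PairDominates : Fin n → Fin n × Fin n → Set
  PairDominates w (u , v) = InClosedNbhd G u w × InClosedNbhd G v w

  Covered : Subset n → List (Fin n × Fin n) → Set
  Covered A R = ∀ w → Any (PairDominates w) R ⊎ Dominates A w

  dominating? : (S : Subset n) → Dec (Dominating G S)
  dominating? S = all? λ w → any? λ u →
    (u ∈? S) ×-dec ((w ≟ u) ⊎-dec (adj G u w Bool.≟ true))

  covered-[]⇒dominating : ∀ {A} → Covered A [] → Dominating G A
  covered-[]⇒dominating cov w with cov w
  ... | inj₂ A-dominates-w = A-dominates-w

  endpoint-dominates : ∀ {x p w} → x ∈ᵖ p → PairDominates w p → InClosedNbhd G x w
  endpoint-dominates {p = _ , _} (inj₁ refl) (u~w , _) = u~w
  endpoint-dominates {p = _ , _} (inj₂ refl) (_ , v~w) = v~w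

  covered-removal : ∀ {A x R} → Covered A R → (r : Removal x R) →
                    Covered (A ∪ ⁅ x ⁆) (Removal.rest r)
  covered-removal {x = x} cov r w with cov w
  ... | inj₂ (u , u∈A , u~w) = inj₂ (u , x∈p∪q⁺ (inj₁ u∈A) , u~w)
  ... | inj₁ some-pair with find some-pair
  ...   | p , p∈R , p~w with Removal.covered r p∈R
  ...     | inj₁ p∈rest = inj₁ (lose p∈rest p~w)
  ...     | inj₂ x∈p    = inj₂ (x , x∈p∪q⁺ (inj₂ (x∈⁅x⁆ x)) , endpoint-dominates x∈p p~w)

  unclaimed-removal : ∀ {A B x R} → All (Unclaimed G A B) (vertices R) → (r : Removal x R) →
                      All (Unclaimed G (A ∪ ⁅ x ⁆) B) (vertices (Removal.rest r))
  unclaimed-removal unclaimed r =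
    All.zipWith (λ (x≢y , y∉A , y∉B) → x∉p∪⁅y⁆ y∉A (≢-sym x≢y) , y∉B)
                (Removal.x∉rest r , anti-mono (Removal.rest⊆R r) unclaimed)

  unclaimed-claimᴮ : ∀ {A B v ys} → All (Unclaimed G A B) ys → All (v ≢_) ys →
                     All (Unclaimed G A (B ∪ ⁅ v ⁆)) ys
  unclaimed-claimᴮ unclaimed v∉ys =
    All.zipWith (λ ((y∉A , y∉B) , v≢y) → y∉A , x∉p∪⁅y⁆ y∉B (≢-sym v≢y)) (unclaimed , v∉ys)

  aliceClaims : ∀ {A B} x → Unclaimed G A B x →
                (¬ Dominating G (A ∪ ⁅ x ⁆) → AliceWinsBobToMove G (A ∪ ⁅ x ⁆) B) →
                AliceWinsAliceToMove G A B
  aliceClaims {A} x x-unclaimed continue with dominating? (A ∪ ⁅ x ⁆)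
  ... | yes dominating = winNow x x-unclaimed dominating
  ... | no ¬dominating = move x x-unclaimed ¬dominating (continue ¬dominating)

  module Strategy (k : ℕ) (k-minimal : ∀ S → Dominating G S → k ≤ ∣ S ∣) where

    -- Bob is to move, and R lists the pairs neither player has touched yet.
    record Position (A B : Subset n) (R : List (Fin n × Fin n)) : Set where
      field
        unclaimed : All (Unclaimed G A B) (vertices R)
        unique    : Unique (vertices R)
        covered   : Covered A R
        budget    : ∣ B ∣ + length R < k

    bobCannotDominate : ∀ {A B p R} → Position A B (p ∷ R) → ∀ v → ¬ Dominating G (B ∪ ⁅ v ⁆)
    bobCannotDominate {B = B} {R = R} pos v dominating = <-irrefl refl (begin-strict
      k                      ≤⟨ k-minimal _ dominating ⟩
      ∣ B ∪ ⁅ v ⁆ ∣          ≤⟨ ∣p∪⁅x⁆∣≤1+∣p∣ B v ⟩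
      suc ∣ B ∣              ≤⟨ s≤s (m≤m+n ∣ B ∣ (length R)) ⟩
      suc (∣ B ∣ + length R) ≡⟨ sym (+-suc ∣ B ∣ (length R)) ⟩
      ∣ B ∣ + suc (length R) <⟨ Position.budget pos ⟩
      k                      ∎)
      where open ≤-Reasoning

    exchange : ∀ {A B R x v} → Position A B R → (r : Removal x R) →
               All (v ≢_) (vertices (Removal.rest r)) →
               Position (A ∪ ⁅ x ⁆) (B ∪ ⁅ v ⁆) (Removal.rest r)
    exchange {B = B} {R} {v = v} pos r v∉rest = record
      { unclaimed = unclaimed-claimᴮ (unclaimed-removal unclaimed r) v∉rest
      ; unique    = Removal.unique r
      ; covered   = covered-removal covered r
      ; budget    = begin-strict
          ∣ B ∪ ⁅ v ⁆ ∣ + length rest ≤⟨ +-monoˡ-≤ (length rest) (∣p∪⁅x⁆∣≤1+∣p∣ B v) ⟩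
          suc (∣ B ∣ + length rest)   ≡⟨ sym (+-suc ∣ B ∣ (length rest)) ⟩
          ∣ B ∣ + suc (length rest)   ≡⟨ cong (∣ B ∣ +_) (sym (Removal.length-rest r)) ⟩
          ∣ B ∣ + length R            <⟨ budget ⟩
          k                           ∎
      }
      where
        open Position pos
        open Removal r using (rest)
        open ≤-Reasoning

    aliceWinsBobToMove : ∀ m {A B R} → length R ≡ m → Position A B R → ¬ Dominating G A →
                         AliceWinsBobToMove G A B
    aliceWinsBobToMove _ {R = []} _ pos ¬dominating =
      ⊥-elim (¬dominating (covered-[]⇒dominating (Position.covered pos)))
    aliceWinsBobToMove zero {R = _ ∷ _} ()
    aliceWinsBobToMove (suc m) {A} {B} {(a , b) ∷ R} |R|≡1+m pos _ =
      bobMoves (a , All.head (Position.unclaimed pos)) λ v _ →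
        bobCannotDominate pos v , aliceAnswers v
      where
        aliceAnswers : ∀ v → AliceWinsAliceToMove G A (B ∪ ⁅ v ⁆)
        aliceAnswers v with respond v (Position.unique pos)
        ... | x , x≢v , r , v∉rest =
          aliceClaims x x-unclaimed λ ¬dominating →
            aliceWinsBobToMove m (suc-injective (trans (sym (Removal.length-rest r)) |R|≡1+m))
              (exchange pos r v∉rest) ¬dominating
          where
            x-unclaimed : Unclaimed G A (B ∪ ⁅ v ⁆) x
            x-unclaimed = map₂ (λ x∉B → x∉p∪⁅y⁆ x∉B x≢v)
                               (All.lookup (Position.unclaimed pos) (Removal.x∈R r))

  -- The vertex is needed: without one, the empty pairing has size γ = 0 but nobody can move.
  aliceWins : (R : List (Fin n × Fin n)) → Unique (vertices R) → Covered ⊥ R →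
              (∀ S → Dominating G S → length R ≤ ∣ S ∣) → Fin n → AliceHasWinningStrategy G
  aliceWins [] _ cov _ w with cov w
  ... | inj₂ (_ , u∈⊥ , _) = ⊥-elim (∉⊥ u∈⊥)
  aliceWins ((a , b) ∷ R) unique cov minimal _ =
    aliceClaims a (∉⊥ , ∉⊥) λ ¬dominating →
      aliceWinsBobToMove (length R) refl opening ¬dominating
    where
      open Strategy (length ((a , b) ∷ R)) minimal
      opened : Removal a ((a , b) ∷ R)
      opened = removeHead (inj₁ refl) unique
      opening : Position (⊥ ∪ ⁅ a ⁆) ⊥ R
      opening = record
        { unclaimed = unclaimed-removal (All.tabulate λ _ → ∉⊥ , ∉⊥) opened
        ; unique    = Removal.unique opened
        ; covered   = covered-removal cov opened
        ; budget    = ≤-reflexive (cong (λ z → suc (z + length R)) (∣⊥∣≡0 n))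
        }

pairVertices≡vertices : ∀ {n} (G : Graph n) R → pairVertices G R ≡ PairRemoval.vertices (_≟_ {n}) R
pairVertices≡vertices G []            = refl
pairVertices≡vertices G ((u , v) ∷ R) = cong (λ vs → u ∷ v ∷ vs) (pairVertices≡vertices G R)

lemma6 : ∀ {n : ℕ} (G : Graph (suc n)) (P : PairingDominatingSet G) →
         IsDominationNumber G (size G P) → AliceHasWinningStrategy G
lemma6 G P (_ , minimal) =
  aliceWins G pairs (subst Unique (pairVertices≡vertices G pairs) distinct)
    (λ w → inj₁ (Any.map (λ { {_ , _} both → both }) (covers w))) minimal Data.Fin.zero
  where open PairingDominatingSet P
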